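{- Let $\kappa\geq 3$ be an integer and for every prime $p$ let $\omega(p)$ be a nonnegative integer. Suppose there is a finite set of primes $\mathcal{P}_0$ such that $\omega(p)<\kappa$ for all $p\in\mathcal{P}_0$, $\omega(p)=\kappa$ for all primes $p\notin\mathcal{P}_0$, and $\omega(p)<p$ for all primes $p$. Define $\omega_0(p)=\kappa$ for $p>\kappa$ and $\omega_0(p)=\omega(p)$ for $p\le\kappa$. For a function $h$ on primes with $0\le h(p)<p$ set \[L(z,h)=\sum_{q\leq z}\mu^2(q)\prod_{p\mid q}\frac{h(p)}{p-h(p)}.\] Then for all $z>0$, \[L(z,\omega) \geq \prod_{\substack{p\in \mathcal{P}_0\\ p>\kappa}}\frac{p-\kappa}{p-\omega(p)}\,L(z,\omega_0).\]
   Context: $\mu$ is the Möbius function; the sum runs over positive integers $q\le z$ and products over primes. -}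

module Defs where

open import Data.Bool using (Bool; true; false; if_then_else_; _∧_)
open import Data.Nat as ℕ using (ℕ; zero; suc; _≤ᵇ_)
open import Data.Nat.Divisibility using (_∣?_)
open import Data.Nat.Primality using (prime?)
open import Data.Integer as ℤ using (ℤ; +_; -_)
open import Data.Rational as ℚ using (ℚ; 0ℚ; 1ℚ)
open import Data.List using (List; []; _∷_; filter; applyUpTo; upTo; foldr; map; length)
open import Relation.Nullary.Decidable using (_×-dec_; does)

primeDivisors : ℕ → List ℕ
primeDivisors q = filter (λ p → prime? p ×-dec (p ∣? q)) (upTo (suc q))

-- q is squarefree: no d ≥ 2 with d² ∣ q  (for q ≥ 1 any such d satisfies d ≤ q)
squarefreeᵇ : ℕ → Bool
squarefreeᵇ q = foldr _∧_ true (map (λ d → if 2 ≤ᵇ d then (if does ((d ℕ.* d) ∣? q) then false else true) else true) (upTo (suc q)))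

μ : ℕ → ℤ
μ q = if squarefreeᵇ q then sgn (length (primeDivisors q)) else + 0
  where
  sgn : ℕ → ℤ
  sgn zero = + 1
  sgn (suc k) = - sgn k

-- a / b as a rational; the hypotheses guarantee b ≠ 0 wherever used
ratio : ℕ → ℕ → ℚ
ratio a zero = 0ℚ
ratio a (suc b) = (+ a) ℚ./ suc b

prodℚ : List ℚ → ℚ
prodℚ = foldr ℚ._*_ 1ℚ

sumℚ : List ℚ → ℚ
sumℚ = foldr ℚ._+_ 0ℚ

-- L(z,h) = Σ_{1 ≤ q ≤ z} μ²(q) Π_{p ∣ q} h(p)/(p - h(p)),  with N = ⌊z⌋
L : ℕ → (ℕ → ℕ) → ℚ
L N h = sumℚ (applyUpTo (λ i → term (suc i)) N)
  where
  term : ℕ → ℚ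
  term q = ((μ q ℤ.* μ q) ℚ./ 1) ℚ.* prodℚ (map (λ p → ratio (h p) (p ℕ.∸ h p)) (primeDivisors q))

ω₀ : ℕ → (ℕ → ℕ) → ℕ → ℕ
ω₀ κ ω p = if p ≤ᵇ κ then ω p else κ

module Submission where

-- Write g_h(p) = h(p)/(p - h(p)), so that L(z,h) sums μ²(q) Π_{p ∣ q} g_h(p).
-- The primes p ∈ P₀ with p > κ are handled one at a time, changing h(p) from κ to ω(p).
-- For a fixed prime p, splitting q according to p ∤ q or p ∣ q gives L(z,h) = X + g_h(p) Y,
-- where X and Y sum the summand with its factor at p removed, so neither depends on h(p);
-- and Y ≤ X, since a squarefree multiple q = pk ≤ z contributes to Y what k contributes to X.
-- With c = (p - κ)/(p - ω(p)) ≤ 1 one has c (1 + g_κ(p)) = 1 + g_ω(p), and then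
-- (X + g_ω(p) Y) - c (X + g_κ(p) Y) = (1 - c)(X - Y) ≥ 0.

open import Defs
open import Data.Bool using (Bool; true; false; T; if_then_else_)
open import Data.Empty using (⊥-elim)
open import Data.Integer as ℤ using (ℤ; +_; -_)
import Data.Integer.Properties as ℤ
open import Data.List using (List; []; _∷_; map; filter; applyUpTo; upTo; length)
open import Data.List.Properties using (map-cong-local)
open import Data.List.Membership.Propositional using (_∈_; _∉_)
open import Data.List.Membership.Propositional.Properties
  using (∈-filter⁺; ∈-filter⁻; ∈-upTo⁺; ∈-upTo⁻)
open import Data.List.Membership.Propositional.Properties.WithK using (unique∧set⇒bag)
open import Data.List.Relation.Binary.BagAndSetEquality using (∼bag⇒↭)
open import Data.List.Relation.Binary.Permutation.Propositional using (_↭_; ↭⇒↭ₛ)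
import Data.List.Relation.Binary.Permutation.Propositional.Properties as ↭
open import Data.List.Relation.Binary.Permutation.Setoid.Properties using (foldr-commMonoid)
open import Data.List.Relation.Unary.All as All using (All)
open import Data.List.Relation.Unary.All.Properties
  using (all⁺; all⁻; ¬Any⇒All¬) renaming (map⁺ to All-map⁺)
import Data.List.Relation.Unary.AllPairs as AllPairs
open import Data.List.Relation.Unary.Any using (here; there)
open import Data.List.Relation.Unary.Unique.Propositional using (Unique)
open import Data.List.Relation.Unary.Unique.Propositional.Properties using (filter⁺; upTo⁺)
open import Data.Nat as ℕ using (ℕ; zero; suc; _≤_; _<_; _∸_; _≤ᵇ_; s≤s; NonZero)
import Data.Nat.Properties as ℕ
open import Data.Nat.Properties using (_<?_)
open import Data.Nat.Divisibility
  using (_∣_; _∣?_; ∣⇒≤; ∣-trans; ∣n⇒∣m*n; m∣m*n; n∣m*n; *-monoʳ-∣; divides)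
open import Data.Nat.Primality
  using (Prime; prime?; euclidsLemma; prime⇒irreducible; prime⇒nonZero; prime⇒nonTrivial)
import Data.Nat.Tactic.RingSolver as ℕ-Solver
open import Data.Product using (_×_; _,_; proj₂)
open import Data.Rational as ℚ using (ℚ; 0ℚ; 1ℚ; toℚᵘ)
import Data.Rational.Properties as ℚ
open import Data.Rational.Solver using (module +-*-Solver)
open import Data.Rational.Unnormalised as ℚᵘ using (mkℚᵘ; *≡*; *≤*)
import Data.Rational.Unnormalised.Properties as ℚᵘ
open import Data.Sum using (_⊎_; inj₁; inj₂)
open import Data.Unit using (tt)
open import Function using (_∘_; mk⇔)
open import Relation.Nullary using (¬_; does; yes; no)
open import Relation.Nullary.Decidable using (T?; _×-dec_; dec-true; dec-false)
open import Relation.Nullary.Reflects using (ofʸ; ofⁿ)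
open import Relation.Binary.PropositionalEquality

sumTo : ℕ → (ℕ → ℚ) → ℚ
sumTo N f = sumℚ (applyUpTo (f ∘ suc) N)

sumTo-suc : ∀ N f → sumTo (suc N) f ≡ sumTo N f ℚ.+ f (suc N)
sumTo-suc zero    f = trans (ℚ.+-identityʳ (f 1)) (sym (ℚ.+-identityˡ (f 1)))
sumTo-suc (suc N) f =
  trans (cong (f 1 ℚ.+_) (sumTo-suc N (f ∘ suc))) (sym (ℚ.+-assoc (f 1) _ _))

sumTo-cong : ∀ N {f g} → (∀ q .{{_ : NonZero q}} → f q ≡ g q) → sumTo N f ≡ sumTo N g
sumTo-cong zero    f≗g = refl
sumTo-cong (suc N) f≗g = cong₂ ℚ._+_ (f≗g 1) (sumTo-cong N λ q → f≗g (suc q))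

sumTo-+-* : ∀ N f g a → sumTo N (λ q → f q ℚ.+ a ℚ.* g q) ≡ sumTo N f ℚ.+ a ℚ.* sumTo N g
sumTo-+-* zero    f g a = sym (trans (ℚ.+-identityˡ _) (ℚ.*-zeroʳ a))
sumTo-+-* (suc N) f g a =
  trans (cong (f 1 ℚ.+ a ℚ.* g 1 ℚ.+_) (sumTo-+-* N (f ∘ suc) (g ∘ suc) a))
        (interchange (f 1) (g 1) (sumTo N (f ∘ suc)) (sumTo N (g ∘ suc)) a)
  where
  open +-*-Solver
  interchange : ∀ x y s t a →
    (x ℚ.+ a ℚ.* y) ℚ.+ (s ℚ.+ a ℚ.* t) ≡ (x ℚ.+ s) ℚ.+ a ℚ.* (y ℚ.+ t)
  interchange = solve 5 (λ x y s t a →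
    (x :+ a :* y) :+ (s :+ a :* t) := (x :+ s) :+ a :* (y :+ t)) refl

sumTo-nonneg : ∀ N {f} → (∀ q → 0ℚ ℚ.≤ f q) → 0ℚ ℚ.≤ sumTo N f
sumTo-nonneg zero    f≥0 = ℚ.≤-refl
sumTo-nonneg (suc N) f≥0 = ℚ.+-mono-≤ (f≥0 1) (sumTo-nonneg N (f≥0 ∘ suc))

sumTo-mono : ∀ {f} → (∀ q → 0ℚ ℚ.≤ f q) → ∀ {m n} → m ≤ n → sumTo m f ℚ.≤ sumTo n f
sumTo-mono     f≥0 {zero}  {n}     _         = sumTo-nonneg n f≥0
sumTo-mono {f} f≥0 {suc m} {suc n} (s≤s m≤n) =
  ℚ.+-monoʳ-≤ (f 1) (sumTo-mono {f ∘ suc} (f≥0 ∘ suc) m≤n)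

onMultiples offMultiples : ℕ → (ℕ → ℚ) → ℕ → ℚ
onMultiples  p F q = if does (p ∣? q) then F q else 0ℚ
offMultiples p F q = if does (p ∣? q) then 0ℚ else F q

onMultiples-cong : ∀ p {F G} → (∀ q → F q ≡ G q) → ∀ q → onMultiples p F q ≡ onMultiples p G q
onMultiples-cong p F≗G q = cong (λ t → if does (p ∣? q) then t else 0ℚ) (F≗G q)

offMultiples-cong : ∀ p {F G} → (∀ q → F q ≡ G q) → ∀ q → offMultiples p F q ≡ offMultiples p G q
offMultiples-cong p F≗G q = cong (λ t → if does (p ∣? q) then 0ℚ else t) (F≗G q)

sumTo-onMultiples-≤ : ∀ p .{{_ : NonZero p}} {F G : ℕ → ℚ} → (∀ k → 0ℚ ℚ.≤ G k) →
  (∀ k → F (p ℕ.* suc k) ℚ.≤ G (suc k)) → ∀ N → sumTo N (onMultiples p F) ℚ.≤ sumTo N G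
sumTo-onMultiples-≤ p {F} {G} G≥0 F≤G N =
  bound N N (ℕ.<-≤-trans (ℕ.n<1+n N) (ℕ.m≤n*m (suc N) p))
  where
  -- The bound N < p (m + 1) ensures that every multiple p k ≤ N has k ≤ m.
  bound : ∀ N m → N < p ℕ.* suc m → sumTo N (onMultiples p F) ℚ.≤ sumTo m G
  bound zero    m _ = sumTo-nonneg m G≥0
  bound (suc N) m N<pm rewrite sumTo-suc N (onMultiples p F) with p ∣? suc N
  ... | no _ = begin
    sumTo N (onMultiples p F) ℚ.+ 0ℚ  ≡⟨ ℚ.+-identityʳ _ ⟩
    sumTo N (onMultiples p F)         ≤⟨ bound N m (ℕ.<-trans (ℕ.n<1+n N) N<pm) ⟩
    sumTo m G                         ∎
    where open ℚ.≤-Reasoning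
  ... | yes (divides zero ())
  ... | yes (divides (suc k) N+1≡kp) = begin
    sumTo N (onMultiples p F) ℚ.+ F (suc N)  ≤⟨ ℚ.+-mono-≤ (bound N k (ℕ.≤-reflexive N+1≡pk)) Fp≤G ⟩
    sumTo k G ℚ.+ G (suc k)                  ≡⟨ sumTo-suc k G ⟨
    sumTo (suc k) G                          ≤⟨ sumTo-mono G≥0 k<m ⟩
    sumTo m G                                ∎
    where
    open ℚ.≤-Reasoning
    N+1≡pk : suc N ≡ p ℕ.* suc k
    N+1≡pk = trans N+1≡kp (ℕ.*-comm (suc k) p)
    Fp≤G : F (suc N) ℚ.≤ G (suc k)
    Fp≤G = subst (λ q → F q ℚ.≤ G (suc k)) (sym N+1≡pk) (F≤G k)
    k<m : suc k ≤ m
    k<m = ℕ.≤-pred (ℕ.*-cancelˡ-< p (suc k) (suc m) (subst (_< p ℕ.* suc m) N+1≡pk N<pm))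

private
  noSquareFactorᵇ : ℕ → ℕ → Bool
  noSquareFactorᵇ q d = if 2 ≤ᵇ d then (if does (d ℕ.* d ∣? q) then false else true) else true

squarefreeᵇ-sound : ∀ {q d} → T (squarefreeᵇ q) → 2 ≤ d → d ≤ q → ¬ d ℕ.* d ∣ q
squarefreeᵇ-sound {q} {d} sqf 2≤d d≤q dd∣q
  with 2 ≤ᵇ d in 2≤ᵇd | d ℕ.* d ∣? q
     | All.lookup (all⁺ (noSquareFactorᵇ q) (upTo (suc q)) sqf) (∈-upTo⁺ (s≤s d≤q))
... | false | _        | _  = subst T 2≤ᵇd (ℕ.≤⇒≤ᵇ 2≤d)
... | true  | no ¬dd∣q | _  = ¬dd∣q dd∣q
... | true  | yes _    | ()

squarefreeᵇ-complete : ∀ {q} → (∀ {d} → 2 ≤ d → d ≤ q → ¬ d ℕ.* d ∣ q) → T (squarefreeᵇ q)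
squarefreeᵇ-complete {q} sqf =
  all⁻ (noSquareFactorᵇ q) (All.tabulate λ {d} d∈ → noSquare d (ℕ.≤-pred (∈-upTo⁻ d∈)))
  where
  noSquare : ∀ d → d ≤ q → T (noSquareFactorᵇ q d)
  noSquare d d≤q with 2 ≤ᵇ d in 2≤ᵇd | d ℕ.* d ∣? q
  ... | false | _        = tt
  ... | true  | no _     = tt
  ... | true  | yes dd∣q = sqf (ℕ.≤ᵇ⇒≤ 2 d (subst T (sym 2≤ᵇd) tt)) d≤q dd∣q

squarefreeᵇ-∣ : ∀ {d q} .{{_ : NonZero q}} → d ∣ q → T (squarefreeᵇ q) → T (squarefreeᵇ d)
squarefreeᵇ-∣ d∣q sqf = squarefreeᵇ-complete λ 2≤e e≤d ee∣d →
  squarefreeᵇ-sound sqf 2≤e (ℕ.≤-trans e≤d (∣⇒≤ d∣q)) (∣-trans ee∣d d∣q)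

alternating-±1 : ∀ {s : ℕ → ℤ} → s 0 ≡ + 1 → (∀ n → s (suc n) ≡ - s n) →
  ∀ n → s n ≡ + 1 ⊎ s n ≡ - + 1
alternating-±1 s0 s-suc zero = inj₁ s0
alternating-±1 s0 s-suc (suc n) with alternating-±1 s0 s-suc n
... | inj₁ sn≡1  = inj₂ (trans (s-suc n) (cong -_ sn≡1))
... | inj₂ sn≡-1 = inj₁ (trans (s-suc n) (cong -_ sn≡-1))

-- The sign function of μ is local to μ's where-block in Defs and cannot be named. The third
-- with-expression leaves it as a metavariable, which unification with the abstracted goal
-- solves (its context does not contain n, so the constraint is a pattern).
μ-squarefree : ∀ q → T (squarefreeᵇ q) → μ q ≡ + 1 ⊎ μ q ≡ - + 1
μ-squarefree q sqf
  with squarefreeᵇ q in sqf-q | length (primeDivisors q) | alternating-±1 refl (λ _ → refl)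
... | true  | n | ±1 = ±1 n
... | false | _ | _  = ⊥-elim (subst T sqf-q sqf)

μ² : ℕ → ℚ
μ² q = (μ q ℤ.* μ q) ℚ./ 1

μ²-squarefree : ∀ q → T (squarefreeᵇ q) → μ² q ≡ 1ℚ
μ²-squarefree q sqf with μ q | μ-squarefree q sqf
... | _ | inj₁ refl = refl
... | _ | inj₂ refl = refl

μ²-¬squarefree : ∀ q → ¬ T (squarefreeᵇ q) → μ² q ≡ 0ℚ
μ²-¬squarefree q ¬sqf with squarefreeᵇ q
... | true  = ⊥-elim (¬sqf tt)
... | false = refl

μ²-nonneg : ∀ q → 0ℚ ℚ.≤ μ² q
μ²-nonneg q with T? (squarefreeᵇ q)
... | yes sqf = subst (0ℚ ℚ.≤_) (sym (μ²-squarefree q sqf)) (ℚ.nonNegative⁻¹ 1ℚ)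
... | no ¬sqf = ℚ.≤-reflexive (sym (μ²-¬squarefree q ¬sqf))

μ²-∣-≤ : ∀ {d q} .{{_ : NonZero q}} → d ∣ q → μ² q ℚ.≤ μ² d
μ²-∣-≤ {d} {q} d∣q with T? (squarefreeᵇ q)
... | yes sqf = ℚ.≤-reflexive
  (trans (μ²-squarefree q sqf) (sym (μ²-squarefree d (squarefreeᵇ-∣ d∣q sqf))))
... | no ¬sqf = subst (ℚ._≤ μ² d) (sym (μ²-¬squarefree q ¬sqf)) (μ²-nonneg d)

μ²-square-∣ : ∀ {d q} .{{_ : NonZero q}} → 2 ≤ d → d ℕ.* d ∣ q → μ² q ≡ 0ℚ
μ²-square-∣ {d@(suc _)} {q} 2≤d dd∣q = μ²-¬squarefree q λ sqf →
  squarefreeᵇ-sound sqf 2≤d (ℕ.≤-trans (ℕ.m≤m*n d d) (∣⇒≤ dd∣q)) dd∣q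

∈-primeDivisors⁻ : ∀ {x n} → x ∈ primeDivisors n → Prime x × x ∣ n
∈-primeDivisors⁻ {n = n} = proj₂ ∘ ∈-filter⁻ (λ p → prime? p ×-dec p ∣? n) {xs = upTo (suc n)}

∈-primeDivisors⁺ : ∀ {x n} .{{_ : NonZero n}} → Prime x → x ∣ n → x ∈ primeDivisors n
∈-primeDivisors⁺ {n = n} px x∣n =
  ∈-filter⁺ (λ p → prime? p ×-dec p ∣? n) (∈-upTo⁺ (s≤s (∣⇒≤ x∣n))) (px , x∣n)

primeDivisors-unique : ∀ n → Unique (primeDivisors n)
primeDivisors-unique n = filter⁺ (λ p → prime? p ×-dec p ∣? n) (upTo⁺ (suc n))

prime-∣-prime : ∀ {x p} → Prime x → Prime p → x ∣ p → x ≡ p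
prime-∣-prime {x} px pp x∣p with prime⇒irreducible pp x∣p
... | inj₂ x≡p = x≡p
... | inj₁ refl with () ← prime⇒nonTrivial px

primeDivisors-*-↭ : ∀ {p k} → Prime p → ¬ p ∣ k → primeDivisors (p ℕ.* k) ↭ p ∷ primeDivisors k
primeDivisors-*-↭ {p} {zero}      pp p∤k = ⊥-elim (p∤k (divides 0 refl))
primeDivisors-*-↭ {p} {k@(suc _)} pp p∤k = ∼bag⇒↭ (unique∧set⇒bag
  (primeDivisors-unique (p ℕ.* k))
  (¬Any⇒All¬ _ p∉ AllPairs.∷ primeDivisors-unique k)
  (mk⇔ to from))
  where
  instance
    _ = prime⇒nonZero pp
    _ = ℕ.m*n≢0 p k
  p∉ : p ∉ primeDivisors k
  p∉ = p∤k ∘ proj₂ ∘ ∈-primeDivisors⁻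
  to : ∀ {x} → x ∈ primeDivisors (p ℕ.* k) → x ∈ p ∷ primeDivisors k
  to x∈ with ∈-primeDivisors⁻ x∈
  ... | px , x∣pk with euclidsLemma p k px x∣pk
  ...   | inj₁ x∣p = here (prime-∣-prime px pp x∣p)
  ...   | inj₂ x∣k = there (∈-primeDivisors⁺ px x∣k)
  from : ∀ {x} → x ∈ p ∷ primeDivisors k → x ∈ primeDivisors (p ℕ.* k)
  from (here refl) = ∈-primeDivisors⁺ pp (m∣m*n k)
  from (there x∈) with px , x∣k ← ∈-primeDivisors⁻ x∈ = ∈-primeDivisors⁺ px (∣n⇒∣m*n p x∣k)

prodℚ-↭ : ∀ {xs ys} → xs ↭ ys → prodℚ xs ≡ prodℚ ys
prodℚ-↭ = foldr-commMonoid (setoid ℚ) ℚ.*-1-isCommutativeMonoid ∘ ↭⇒↭ₛ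

*-nonneg : ∀ {a b} → 0ℚ ℚ.≤ a → 0ℚ ℚ.≤ b → 0ℚ ℚ.≤ a ℚ.* b
*-nonneg {a} {b} a≥0 b≥0 =
  ℚ.nonNegative⁻¹ _ {{ℚ.nonNeg*nonNeg⇒nonNeg a {{ℚ.nonNegative a≥0}} b {{ℚ.nonNegative b≥0}}}}

prodℚ-nonneg : ∀ {xs} → All (0ℚ ℚ.≤_) xs → 0ℚ ℚ.≤ prodℚ xs
prodℚ-nonneg All.[]           = ℚ.nonNegative⁻¹ 1ℚ
prodℚ-nonneg (x≥0 All.∷ xs≥0) = *-nonneg x≥0 (prodℚ-nonneg xs≥0)

primeProduct : (ℕ → ℚ) → ℕ → ℚ
primeProduct f q = prodℚ (map f (primeDivisors q))

primeProduct-cong : ∀ {f g} q → (∀ {x} → Prime x → x ∣ q → f x ≡ g x) →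
  primeProduct f q ≡ primeProduct g q
primeProduct-cong q f≗g = cong prodℚ (map-cong-local (All.tabulate λ x∈ →
  let px , x∣q = ∈-primeDivisors⁻ x∈ in f≗g px x∣q))

primeProduct-nonneg : ∀ {f} → (∀ x → 0ℚ ℚ.≤ f x) → ∀ q → 0ℚ ℚ.≤ primeProduct f q
primeProduct-nonneg f≥0 q = prodℚ-nonneg (All-map⁺ (All.universal f≥0 (primeDivisors q)))

primeProduct-* : ∀ f {p k} → Prime p → ¬ p ∣ k → primeProduct f (p ℕ.* k) ≡ f p ℚ.* primeProduct f k
primeProduct-* f pp p∤k = prodℚ-↭ (↭.map⁺ f (primeDivisors-*-↭ pp p∤k))

summand : (ℕ → ℚ) → ℕ → ℚ
summand f q = μ² q ℚ.* primeProduct f q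

summand-cong : ∀ {f g} q → (∀ {x} → Prime x → f x ≡ g x) → summand f q ≡ summand g q
summand-cong q f≗g = cong (μ² q ℚ.*_) (primeProduct-cong q λ px _ → f≗g px)

summand-nonneg : ∀ {f} → (∀ x → 0ℚ ℚ.≤ f x) → ∀ q → 0ℚ ℚ.≤ summand f q
summand-nonneg f≥0 q = *-nonneg (μ²-nonneg q) (primeProduct-nonneg f≥0 q)

sieveSum : ℕ → (ℕ → ℚ) → ℚ
sieveSum N f = sumTo N (summand f)

sieveSum-cong : ∀ N {f g} → (∀ {x} → Prime x → f x ≡ g x) → sieveSum N f ≡ sieveSum N g
sieveSum-cong N f≗g = sumTo-cong N λ q → summand-cong q f≗g

_[_≔_] : (ℕ → ℚ) → ℕ → ℚ → ℕ → ℚ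
(f [ p ≔ a ]) x = if does (x ℕ.≟ p) then a else f x

update-≡ : ∀ f p a → (f [ p ≔ a ]) p ≡ a
update-≡ f p a rewrite dec-true (p ℕ.≟ p) refl = refl

update-≢ : ∀ f {p x} a → x ≢ p → (f [ p ≔ a ]) x ≡ f x
update-≢ f {p} {x} a x≢p rewrite dec-false (x ℕ.≟ p) x≢p = refl

update-nonneg : ∀ {f} p {a} → 0ℚ ℚ.≤ a → (∀ x → 0ℚ ℚ.≤ f x) → ∀ x → 0ℚ ℚ.≤ (f [ p ≔ a ]) x
update-nonneg {f} p {a} a≥0 f≥0 x with x ℕ.≟ p
... | yes refl = subst (0ℚ ℚ.≤_) (sym (update-≡ f p a)) a≥0
... | no  x≢p  = subst (0ℚ ℚ.≤_) (sym (update-≢ f a x≢p)) (f≥0 x)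

update-cong : ∀ {f g} p a → (∀ {x} → Prime x → x ≢ p → f x ≡ g x) →
  ∀ {x} → Prime x → (f [ p ≔ a ]) x ≡ (g [ p ≔ a ]) x
update-cong {f} {g} p a f≗g {x} px with x ℕ.≟ p
... | yes refl = trans (update-≡ f p a) (sym (update-≡ g p a))
... | no  x≢p  = trans (update-≢ f a x≢p) (trans (f≗g px x≢p) (sym (update-≢ g a x≢p)))

rescale-≤ : ∀ {X Y a b c} → Y ℚ.≤ X → c ℚ.≤ 1ℚ → c ℚ.* (1ℚ ℚ.+ b) ≡ 1ℚ ℚ.+ a →
  c ℚ.* (X ℚ.+ b ℚ.* Y) ℚ.≤ X ℚ.+ a ℚ.* Y
rescale-≤ {X} {Y} {a} {b} {c} Y≤X c≤1 rescale = begin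
  c ℚ.* (X ℚ.+ b ℚ.* Y)                               ≡⟨ ℚ.+-identityʳ _ ⟨
  c ℚ.* (X ℚ.+ b ℚ.* Y) ℚ.+ 0ℚ                        ≤⟨ ℚ.+-monoʳ-≤ (c ℚ.* (X ℚ.+ b ℚ.* Y)) slack ⟩
  c ℚ.* (X ℚ.+ b ℚ.* Y) ℚ.+ (1ℚ ℚ.- c) ℚ.* (X ℚ.- Y)  ≡⟨ regroup X Y b c ⟩
  X ℚ.+ (c ℚ.* (1ℚ ℚ.+ b) ℚ.- 1ℚ) ℚ.* Y               ≡⟨ cong (λ t → X ℚ.+ (t ℚ.- 1ℚ) ℚ.* Y) rescale ⟩
  X ℚ.+ ((1ℚ ℚ.+ a) ℚ.- 1ℚ) ℚ.* Y                     ≡⟨ cancel X Y a ⟩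
  X ℚ.+ a ℚ.* Y                                       ∎
  where
  open ℚ.≤-Reasoning
  open +-*-Solver
  0≤- : ∀ {x y} → x ℚ.≤ y → 0ℚ ℚ.≤ y ℚ.- x
  0≤- {x} {y} x≤y = subst (ℚ._≤ y ℚ.- x) (ℚ.+-inverseʳ x) (ℚ.+-monoˡ-≤ (ℚ.- x) x≤y)
  slack : 0ℚ ℚ.≤ (1ℚ ℚ.- c) ℚ.* (X ℚ.- Y)
  slack = *-nonneg (0≤- c≤1) (0≤- Y≤X)
  regroup : ∀ X Y b c → c ℚ.* (X ℚ.+ b ℚ.* Y) ℚ.+ (1ℚ ℚ.- c) ℚ.* (X ℚ.- Y) ≡
                        X ℚ.+ (c ℚ.* (1ℚ ℚ.+ b) ℚ.- 1ℚ) ℚ.* Y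
  regroup = solve 4 (λ X Y b c → c :* (X :+ b :* Y) :+ (con 1ℚ :- c) :* (X :- Y) :=
                                 X :+ (c :* (con 1ℚ :+ b) :- con 1ℚ) :* Y) refl
  cancel : ∀ X Y a → X ℚ.+ ((1ℚ ℚ.+ a) ℚ.- 1ℚ) ℚ.* Y ≡ X ℚ.+ a ℚ.* Y
  cancel = solve 3 (λ X Y a → X :+ ((con 1ℚ :+ a) :- con 1ℚ) :* Y := X :+ a :* Y) refl

reducedSummand : ℕ → (ℕ → ℚ) → ℕ → ℚ
reducedSummand p f = summand (f [ p ≔ 1ℚ ])

module _ {p} (pp : Prime p) where

  private
    instance _ = prime⇒nonZero pp

    2≤p : 2 ≤ p
    2≤p = ℕ.nonTrivial⇒n>1 p {{prime⇒nonTrivial pp}}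

    ∤-update : ∀ f {q} → ¬ p ∣ q → ∀ {x} → x ∣ q → f x ≡ (f [ p ≔ 1ℚ ]) x
    ∤-update f p∤q x∣q = sym (update-≢ f 1ℚ λ { refl → p∤q x∣q })

  summand-p²∣ : ∀ f {k} .{{_ : NonZero k}} → p ∣ k → summand f (p ℕ.* k) ≡ 0ℚ
  summand-p²∣ f {k} p∣k = begin
    μ² (p ℕ.* k) ℚ.* primeProduct f (p ℕ.* k)  ≡⟨ cong (ℚ._* primeProduct f (p ℕ.* k)) μ²≡0 ⟩
    0ℚ ℚ.* primeProduct f (p ℕ.* k)            ≡⟨ ℚ.*-zeroˡ (primeProduct f (p ℕ.* k)) ⟩
    0ℚ                                          ∎
    where
    open ≡-Reasoning
    μ²≡0 : μ² (p ℕ.* k) ≡ 0ℚ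
    μ²≡0 = μ²-square-∣ {{ℕ.m*n≢0 p k}} 2≤p (*-monoʳ-∣ p p∣k)

  summand-coprime : ∀ f {q} → ¬ p ∣ q → summand f q ≡ reducedSummand p f q
  summand-coprime f {q} p∤q = cong (μ² q ℚ.*_) (primeProduct-cong q λ _ → ∤-update f p∤q)

  summand-multiple : ∀ f k → summand f (p ℕ.* suc k) ≡ f p ℚ.* reducedSummand p f (p ℕ.* suc k)
  summand-multiple f k with p ∣? suc k
  ... | yes p∣k = begin
    summand f (p ℕ.* suc k)                     ≡⟨ summand-p²∣ f p∣k ⟩
    0ℚ                                          ≡⟨ ℚ.*-zeroʳ (f p) ⟨
    f p ℚ.* 0ℚ                                  ≡⟨ cong (f p ℚ.*_) (summand-p²∣ (f [ p ≔ 1ℚ ]) p∣k) ⟨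
    f p ℚ.* reducedSummand p f (p ℕ.* suc k)    ∎
    where open ≡-Reasoning
  ... | no  p∤k = begin
    μ² pk ℚ.* primeProduct f pk                 ≡⟨ cong (μ² pk ℚ.*_) (primeProduct-* f pp p∤k) ⟩
    μ² pk ℚ.* (f p ℚ.* primeProduct f (suc k))  ≡⟨ cong (λ t → μ² pk ℚ.* (f p ℚ.* t)) W≡W′ ⟩
    μ² pk ℚ.* (f p ℚ.* W′)                      ≡⟨ shuffle (μ² pk) (f p) W′ ⟩
    f p ℚ.* (μ² pk ℚ.* (1ℚ ℚ.* W′))             ≡⟨ cong (λ t → f p ℚ.* (μ² pk ℚ.* (t ℚ.* W′))) (update-≡ f p 1ℚ) ⟨
    f p ℚ.* (μ² pk ℚ.* (f′ p ℚ.* W′))           ≡⟨ cong (λ t → f p ℚ.* (μ² pk ℚ.* t)) (primeProduct-* f′ pp p∤k) ⟨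
    f p ℚ.* (μ² pk ℚ.* primeProduct f′ pk)      ∎
    where
    open ≡-Reasoning
    open +-*-Solver
    pk = p ℕ.* suc k
    f′ = f [ p ≔ 1ℚ ]
    W′ = primeProduct f′ (suc k)
    W≡W′ : primeProduct f (suc k) ≡ W′
    W≡W′ = primeProduct-cong (suc k) λ _ → ∤-update f p∤k
    shuffle : ∀ m a w → m ℚ.* (a ℚ.* w) ≡ a ℚ.* (m ℚ.* (1ℚ ℚ.* w))
    shuffle = solve 3 (λ m a w → m :* (a :* w) := a :* (m :* (con 1ℚ :* w))) refl

  summand-split : ∀ f q .{{_ : NonZero q}} →
    summand f q ≡ offMultiples p (reducedSummand p f) q ℚ.+ f p ℚ.* onMultiples p (reducedSummand p f) q
  summand-split f q@(suc _) with p ∣? q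
  ... | no  p∤q = begin
    summand f q                                    ≡⟨ summand-coprime f p∤q ⟩
    reducedSummand p f q                           ≡⟨ ℚ.+-identityʳ _ ⟨
    reducedSummand p f q ℚ.+ 0ℚ                    ≡⟨ cong (reducedSummand p f q ℚ.+_) (ℚ.*-zeroʳ (f p)) ⟨
    reducedSummand p f q ℚ.+ f p ℚ.* 0ℚ            ∎
    where open ≡-Reasoning
  ... | yes (divides zero ())
  ... | yes (divides (suc k) q≡kp) =
    subst (λ n → summand f n ≡ 0ℚ ℚ.+ f p ℚ.* reducedSummand p f n) (sym (trans q≡kp (ℕ.*-comm (suc k) p)))
      (trans (summand-multiple f k) (sym (ℚ.+-identityˡ _)))

  sieveSum-split : ∀ f N → sieveSum N f ≡
    sumTo N (offMultiples p (reducedSummand p f)) ℚ.+ f p ℚ.* sumTo N (onMultiples p (reducedSummand p f))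
  sieveSum-split f N = trans (sumTo-cong N (summand-split f))
    (sumTo-+-* N (offMultiples p (reducedSummand p f)) (onMultiples p (reducedSummand p f)) (f p))

  onMultiples≤offMultiples : ∀ {f} → (∀ x → 0ℚ ℚ.≤ f x) → ∀ N →
    sumTo N (onMultiples p (reducedSummand p f)) ℚ.≤ sumTo N (offMultiples p (reducedSummand p f))
  onMultiples≤offMultiples {f} f≥0 = sumTo-onMultiples-≤ p {reducedSummand p f} off≥0 bound
    where
    f′ = f [ p ≔ 1ℚ ]
    f′≥0 : ∀ x → 0ℚ ℚ.≤ f′ x
    f′≥0 = update-nonneg p (ℚ.nonNegative⁻¹ 1ℚ) f≥0
    off≥0 : ∀ q → 0ℚ ℚ.≤ offMultiples p (reducedSummand p f) q
    off≥0 q with p ∣? q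
    ... | yes _ = ℚ.≤-refl
    ... | no  _ = summand-nonneg {f′} f′≥0 q
    bound : ∀ k → reducedSummand p f (p ℕ.* suc k) ℚ.≤ offMultiples p (reducedSummand p f) (suc k)
    bound k with p ∣? suc k
    ... | yes p∣k = ℚ.≤-reflexive (summand-p²∣ f′ p∣k)
    ... | no  p∤k = begin
      μ² (p ℕ.* suc k) ℚ.* primeProduct f′ (p ℕ.* suc k)  ≡⟨ cong (μ² (p ℕ.* suc k) ℚ.*_) W-pk ⟩
      μ² (p ℕ.* suc k) ℚ.* W′                             ≤⟨ ℚ.*-monoʳ-≤-nonNeg W′ {{W≥0}} μ²-pk ⟩
      μ² (suc k) ℚ.* W′                                   ∎
      where
      open ℚ.≤-Reasoning
      W′ = primeProduct f′ (suc k)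
      W-pk : primeProduct f′ (p ℕ.* suc k) ≡ W′
      W-pk = trans (primeProduct-* f′ pp p∤k) (trans (cong (ℚ._* W′) (update-≡ f p 1ℚ)) (ℚ.*-identityˡ W′))
      W≥0 = ℚ.nonNegative (primeProduct-nonneg {f′} f′≥0 (suc k))
      μ²-pk : μ² (p ℕ.* suc k) ℚ.≤ μ² (suc k)
      μ²-pk = μ²-∣-≤ {{ℕ.m*n≢0 p (suc k)}} (n∣m*n p)

  sieveSum-step : ∀ {f g c} → (∀ x → 0ℚ ℚ.≤ f x) → (∀ {x} → Prime x → x ≢ p → f x ≡ g x) →
    c ℚ.≤ 1ℚ → c ℚ.* (1ℚ ℚ.+ g p) ≡ 1ℚ ℚ.+ f p → ∀ N → c ℚ.* sieveSum N g ℚ.≤ sieveSum N f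
  sieveSum-step {f} {g} {c} f≥0 f≗g c≤1 rescale N = begin
    c ℚ.* sieveSum N g       ≡⟨ cong (c ℚ.*_) (trans (sieveSum-split g N) (cong₂ (λ x y → x ℚ.+ g p ℚ.* y) X≡ Y≡)) ⟩
    c ℚ.* (X ℚ.+ g p ℚ.* Y)  ≤⟨ rescale-≤ {X} {Y} {f p} {g p} (onMultiples≤offMultiples f≥0 N) c≤1 rescale ⟩
    X ℚ.+ f p ℚ.* Y          ≡⟨ sieveSum-split f N ⟨
    sieveSum N f             ∎
    where
    open ℚ.≤-Reasoning
    X = sumTo N (offMultiples p (reducedSummand p f))
    Y = sumTo N (onMultiples p (reducedSummand p f))
    same : ∀ q → reducedSummand p g q ≡ reducedSummand p f q
    same q = summand-cong q (update-cong p 1ℚ λ px x≢p → sym (f≗g px x≢p))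
    X≡ : sumTo N (offMultiples p (reducedSummand p g)) ≡ X
    X≡ = sumTo-cong N λ q → offMultiples-cong p same q
    Y≡ : sumTo N (onMultiples p (reducedSummand p g)) ≡ Y
    Y≡ = sumTo-cong N λ q → onMultiples-cong p same q

module _ (c : ℕ → ℚ) {g : ℕ → ℚ} (g≥0 : ∀ x → 0ℚ ℚ.≤ g x) (N : ℕ) where

  sieveSum-chain : ∀ {S h} → Unique S → All (λ s → Prime s × 0ℚ ℚ.≤ c s × c s ℚ.≤ 1ℚ) S →
    (∀ x → 0ℚ ℚ.≤ h x) → (∀ {s} → s ∈ S → c s ℚ.* (1ℚ ℚ.+ g s) ≡ 1ℚ ℚ.+ h s) →
    (∀ {x} → Prime x → x ∉ S → h x ≡ g x) →
    prodℚ (map c S) ℚ.* sieveSum N g ℚ.≤ sieveSum N h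
  sieveSum-chain {[]} _ _ _ _ off-S =
    ℚ.≤-reflexive (trans (ℚ.*-identityˡ _) (sieveSum-cong N λ px → sym (off-S px λ ())))
  sieveSum-chain {s ∷ S} {h} (s∉S AllPairs.∷ uniq) ((ps , cs≥0 , cs≤1) All.∷ cs) h≥0 rescale off-S =
    begin
    c s ℚ.* prodℚ (map c S) ℚ.* sieveSum N g    ≡⟨ ℚ.*-assoc (c s) _ _ ⟩
    c s ℚ.* (prodℚ (map c S) ℚ.* sieveSum N g)  ≤⟨ ℚ.*-monoˡ-≤-nonNeg (c s) {{ℚ.nonNegative cs≥0}} ih ⟩
    c s ℚ.* sieveSum N h′                       ≤⟨ sieveSum-step ps h≥0 h≗h′ cs≤1 rescale-s N ⟩
    sieveSum N h                                ∎
    where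
    open ℚ.≤-Reasoning
    -- h′ undoes the change from g to h at s, so the induction hypothesis applies to it.
    h′ = h [ s ≔ g s ]
    h≗h′ : ∀ {x} → Prime x → x ≢ s → h x ≡ h′ x
    h≗h′ _ x≢s = sym (update-≢ h (g s) x≢s)
    rescale-s : c s ℚ.* (1ℚ ℚ.+ h′ s) ≡ 1ℚ ℚ.+ h s
    rescale-s = trans (cong (λ t → c s ℚ.* (1ℚ ℚ.+ t)) (update-≡ h s (g s))) (rescale (here refl))
    rescale′ : ∀ {t} → t ∈ S → c t ℚ.* (1ℚ ℚ.+ g t) ≡ 1ℚ ℚ.+ h′ t
    rescale′ t∈S = trans (rescale (there t∈S))
      (cong (1ℚ ℚ.+_) (sym (update-≢ h (g s) λ t≡s → All.lookup s∉S t∈S (sym t≡s))))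
    off-S′ : ∀ {x} → Prime x → x ∉ S → h′ x ≡ g x
    off-S′ {x} px x∉S with x ℕ.≟ s
    ... | yes refl = update-≡ h s (g s)
    ... | no  x≢s  = trans (update-≢ h (g s) x≢s) (off-S px λ { (here x≡s) → x≢s x≡s ; (there x∈S) → x∉S x∈S })
    ih : prodℚ (map c S) ℚ.* sieveSum N g ℚ.≤ sieveSum N h′
    ih = sieveSum-chain uniq cs (update-nonneg s (g≥0 s) h≥0) rescale′ off-S′

ratio-nonneg : ∀ a b → 0ℚ ℚ.≤ ratio a b
ratio-nonneg a zero    = ℚ.≤-refl
ratio-nonneg a (suc b) = ℚ.nonNegative⁻¹ _ {{ℚ.normalize-nonNeg a (suc b)}}

ratio≤1 : ∀ {a b} → a ≤ b → ratio a b ℚ.≤ 1ℚ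
ratio≤1 {b = zero}  _   = ℚ.nonNegative⁻¹ 1ℚ
ratio≤1 {a} {suc b} a≤b = ℚ.toℚᵘ-cancel-≤ (ℚᵘ.≤-respˡ-≃ (ℚᵘ.≃-sym (ℚ.toℚᵘ-fromℚᵘ (mkℚᵘ (+ a) b)))
  (*≤* (subst₂ ℤ._≤_ (sym (ℤ.*-identityʳ (+ a))) (sym (ℤ.*-identityˡ (+ suc b))) (ℤ.+≤+ a≤b))))

private
  toℚᵘ-ratio : ∀ a b → toℚᵘ (ratio a (suc b)) ℚᵘ.≃ mkℚᵘ (+ a) b
  toℚᵘ-ratio a b = ℚ.toℚᵘ-fromℚᵘ (mkℚᵘ (+ a) b)

  ratio-cross : ∀ a b c d → a ℕ.* suc d ≡ c ℕ.* suc b → ratio a (suc b) ≡ ratio c (suc d)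
  ratio-cross a b c d eq = ℚ.fromℚᵘ-cong {mkℚᵘ (+ a) b} {mkℚᵘ (+ c) d}
    (*≡* (trans (sym (ℤ.pos-* a (suc d))) (trans (cong +_ eq) (ℤ.pos-* c (suc b)))))

  ratio-+ : ∀ a b c d →
    ratio a (suc b) ℚ.+ ratio c (suc d) ≡ ratio (a ℕ.* suc d ℕ.+ c ℕ.* suc b) (suc b ℕ.* suc d)
  ratio-+ a b c d = ℚ.toℚᵘ-injective (begin
    toℚᵘ (ratio a (suc b) ℚ.+ ratio c (suc d))
      ≈⟨ ℚ.toℚᵘ-homo-+ (ratio a (suc b)) (ratio c (suc d)) ⟩
    toℚᵘ (ratio a (suc b)) ℚᵘ.+ toℚᵘ (ratio c (suc d))
      ≈⟨ ℚᵘ.+-cong (toℚᵘ-ratio a b) (toℚᵘ-ratio c d) ⟩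
    mkℚᵘ (+ a) b ℚᵘ.+ mkℚᵘ (+ c) d
      ≡⟨ cong (λ n → mkℚᵘ n (ℕ.pred (suc b ℕ.* suc d))) numerator ⟩
    mkℚᵘ (+ (a ℕ.* suc d ℕ.+ c ℕ.* suc b)) (ℕ.pred (suc b ℕ.* suc d))
      ≈⟨ toℚᵘ-ratio _ _ ⟨
    toℚᵘ (ratio (a ℕ.* suc d ℕ.+ c ℕ.* suc b) (suc b ℕ.* suc d)) ∎)
    where
    open ℚᵘ.≃-Reasoning
    numerator : + a ℤ.* + suc d ℤ.+ + c ℤ.* + suc b ≡ + (a ℕ.* suc d ℕ.+ c ℕ.* suc b)
    numerator = sym (trans (ℤ.pos-+ (a ℕ.* suc d) (c ℕ.* suc b))
                           (cong₂ ℤ._+_ (ℤ.pos-* a (suc d)) (ℤ.pos-* c (suc b))))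

  ratio-* : ∀ a b c d → ratio a (suc b) ℚ.* ratio c (suc d) ≡ ratio (a ℕ.* c) (suc b ℕ.* suc d)
  ratio-* a b c d = ℚ.toℚᵘ-injective (begin
    toℚᵘ (ratio a (suc b) ℚ.* ratio c (suc d))
      ≈⟨ ℚ.toℚᵘ-homo-* (ratio a (suc b)) (ratio c (suc d)) ⟩
    toℚᵘ (ratio a (suc b)) ℚᵘ.* toℚᵘ (ratio c (suc d))
      ≈⟨ ℚᵘ.*-cong (toℚᵘ-ratio a b) (toℚᵘ-ratio c d) ⟩
    mkℚᵘ (+ a) b ℚᵘ.* mkℚᵘ (+ c) d
      ≡⟨ cong (λ n → mkℚᵘ n (ℕ.pred (suc b ℕ.* suc d))) (sym (ℤ.pos-* a c)) ⟩
    mkℚᵘ (+ (a ℕ.* c)) (ℕ.pred (suc b ℕ.* suc d))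
      ≈⟨ toℚᵘ-ratio _ _ ⟨
    toℚᵘ (ratio (a ℕ.* c) (suc b ℕ.* suc d)) ∎)
    where open ℚᵘ.≃-Reasoning

1+ratio-∸ : ∀ {a n} → a < n → 1ℚ ℚ.+ ratio a (n ∸ a) ≡ ratio n (n ∸ a)
1+ratio-∸ {a} {suc n} (s≤s a≤n) rewrite ℕ.+-∸-assoc 1 a≤n =
  trans (ratio-+ 1 0 a m) (ratio-cross (1 ℕ.* suc m ℕ.+ a ℕ.* 1) (ℕ.pred (1 ℕ.* suc m)) (suc n) m cross)
  where
  m = n ∸ a
  identity : ∀ m a → (1 ℕ.* suc m ℕ.+ a ℕ.* 1) ℕ.* suc m ≡ suc (m ℕ.+ a) ℕ.* (1 ℕ.* suc m)
  identity = ℕ-Solver.solve-∀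
  cross : (1 ℕ.* suc m ℕ.+ a ℕ.* 1) ℕ.* suc m ≡ suc n ℕ.* (1 ℕ.* suc m)
  cross = trans (identity m a) (cong (λ k → suc k ℕ.* (1 ℕ.* suc m)) (ℕ.m∸n+n≡m a≤n))

ratio-cancel : ∀ a b c .{{_ : NonZero b}} → ratio b c ℚ.* ratio a b ≡ ratio a c
ratio-cancel a (suc b) zero    = ℚ.*-zeroˡ (ratio a (suc b))
ratio-cancel a (suc b) (suc c) =
  trans (ratio-* (suc b) c a b) (ratio-cross (suc b ℕ.* a) (ℕ.pred (suc c ℕ.* suc b)) a c (identity a b c))
  where
  identity : ∀ a b c → suc b ℕ.* a ℕ.* suc c ≡ a ℕ.* (suc c ℕ.* suc b)
  identity = ℕ-Solver.solve-∀

ratio-∸-rescale : ∀ {w κ s} → w < s → κ < s →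
  ratio (s ∸ κ) (s ∸ w) ℚ.* (1ℚ ℚ.+ ratio κ (s ∸ κ)) ≡ 1ℚ ℚ.+ ratio w (s ∸ w)
ratio-∸-rescale {w} {κ} {s} w<s κ<s = begin
  ratio (s ∸ κ) (s ∸ w) ℚ.* (1ℚ ℚ.+ ratio κ (s ∸ κ))  ≡⟨ cong (ratio (s ∸ κ) (s ∸ w) ℚ.*_) (1+ratio-∸ κ<s) ⟩
  ratio (s ∸ κ) (s ∸ w) ℚ.* ratio s (s ∸ κ)           ≡⟨ ratio-cancel s (s ∸ κ) (s ∸ w) {{s∸κ≢0}} ⟩
  ratio s (s ∸ w)                                      ≡⟨ 1+ratio-∸ w<s ⟨
  1ℚ ℚ.+ ratio w (s ∸ w)                               ∎
  where
  open ≡-Reasoning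
  s∸κ≢0 = ℕ.>-nonZero (ℕ.m<n⇒0<n∸m κ<s)

-- sieveSum N (weight h) unfolds to L N h.
weight : (ℕ → ℕ) → ℕ → ℚ
weight h p = ratio (h p) (p ∸ h p)

weight-nonneg : ∀ h x → 0ℚ ℚ.≤ weight h x
weight-nonneg h x = ratio-nonneg (h x) (x ∸ h x)

ω₀-≤ : ∀ κ ω {p} → p ≤ κ → ω₀ κ ω p ≡ ω p
ω₀-≤ κ ω {p} p≤κ with p ≤ᵇ κ | ℕ.≤ᵇ-reflects-≤ p κ
... | true  | _        = refl
... | false | ofⁿ p≰κ = ⊥-elim (p≰κ p≤κ)

ω₀-> : ∀ κ ω {p} → κ < p → ω₀ κ ω p ≡ κ
ω₀-> κ ω {p} κ<p with p ≤ᵇ κ | ℕ.≤ᵇ-reflects-≤ p κ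
... | false | _        = refl
... | true  | ofʸ p≤κ = ⊥-elim (ℕ.<⇒≱ κ<p p≤κ)

corollary1 : (κ : ℕ) → 3 ≤ κ → (ω : ℕ → ℕ) → (P₀ : List ℕ) → Unique P₀ → All Prime P₀ →
    (∀ p → Prime p → p ∈ P₀ → ω p < κ) →
    (∀ p → Prime p → p ∉ P₀ → ω p ≡ κ) →
    (∀ p → Prime p → ω p < p) →
    (N : ℕ) →
    prodℚ (map (λ p → ratio (p ∸ κ) (p ∸ ω p)) (filter (κ <?_) P₀)) ℚ.* L N (ω₀ κ ω) ℚ.≤ L N ω
corollary1 κ _ ω P₀ P₀-unique P₀-prime ω<κ ω≡κ _ N =
  sieveSum-chain c (weight-nonneg (ω₀ κ ω)) N (filter⁺ (κ <?_) P₀-unique) (All.tabulate bounds)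
    (weight-nonneg ω) rescale off-S
  where
  S = filter (κ <?_) P₀
  c : ℕ → ℚ
  c p = ratio (p ∸ κ) (p ∸ ω p)
  bounds : ∀ {s} → s ∈ S → Prime s × 0ℚ ℚ.≤ c s × c s ℚ.≤ 1ℚ
  bounds {s} s∈S with s∈P₀ , κ<s ← ∈-filter⁻ (κ <?_) s∈S =
    ps , ratio-nonneg (s ∸ κ) (s ∸ ω s) , ratio≤1 (ℕ.∸-monoʳ-≤ s (ℕ.<⇒≤ (ω<κ s ps s∈P₀)))
    where ps = All.lookup P₀-prime s∈P₀
  rescale : ∀ {s} → s ∈ S → c s ℚ.* (1ℚ ℚ.+ weight (ω₀ κ ω) s) ≡ 1ℚ ℚ.+ weight ω s
  rescale {s} s∈S with s∈P₀ , κ<s ← ∈-filter⁻ (κ <?_) s∈S rewrite ω₀-> κ ω κ<s =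
    ratio-∸-rescale (ℕ.<-trans (ω<κ s (All.lookup P₀-prime s∈P₀) s∈P₀) κ<s) κ<s
  off-S : ∀ {x} → Prime x → x ∉ S → weight ω x ≡ weight (ω₀ κ ω) x
  off-S {x} px x∉S with κ <? x
  ... | yes κ<x = cong (λ t → ratio t (x ∸ t))
    (trans (ω≡κ x px λ x∈P₀ → x∉S (∈-filter⁺ (κ <?_) x∈P₀ κ<x)) (sym (ω₀-> κ ω κ<x)))
  ... | no  κ≮x = cong (λ t → ratio t (x ∸ t)) (sym (ω₀-≤ κ ω (ℕ.≮⇒≥ κ≮x)))
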